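{- Let $n$ be a positive integer, $N=2^n$, and let $\mathrm{IP}_n$ be the $N\times N$ matrix with rows and columns indexed by $x,y\in\{0,1\}^n$ and entries $\mathrm{IP}_n(x,y)=\sum_{i=1}^n x_iy_i \bmod 2$. Then $\mathrm{rank}_{\mathrm{psd}}^{\mathbb{R}}(\mathrm{IP}_n)\le c\sqrt{N}$, where $c=2$ if $n$ is even and $c=\frac{3}{2}\sqrt{2}$ if $n$ is odd.
   Context: For a nonnegative $m\times n$ matrix $A$, a real positive semidefinite factorization of size $r$ consists of $r\times r$ real symmetric positive semidefinite matrices $E_1,\dots,E_m$ and $F_1,\dots,F_n$ with $A(i,j)=\mathrm{Tr}(E_iF_j)$ for all $i,j$. The real PSD-rank $\mathrm{rank}_{\mathrm{psd}}^{\mathbb{R}}(A)$ is the smallest $r$ for which such a factorization exists. -}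

module Defs where

open import Level using (Level; _⊔_)
open import Data.Nat using (ℕ) renaming (zero to nzero; suc to nsuc)
open import Data.Fin using (Fin)
open Fin renaming (zero to fzero; suc to fsuc)
open import Data.Bool using (Bool; true; false; _xor_; _∧_; if_then_else_)
open import Data.Product using (Σ; ∃; _×_; _,_)
open import Relation.Nullary using (¬_)
open import Data.Sum using (_⊎_)
open import Algebra.Bundles using (CommutativeRing)

-- A model of the real numbers: a Dedekind-complete ordered field
-- (unique up to isomorphism, so this is ℝ).  Predicates for the
-- supremum axiom live at level ℓ.
record RealField (c ℓ : Level) : Set (Level.suc (c ⊔ ℓ)) where
  field
    commutativeRing : CommutativeRing c ℓ
  open CommutativeRing commutativeRing public
  field
    _≤_        : Carrier → Carrier → Set ℓ
    ≤-refl     : ∀ {x} → x ≤ x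
    ≤-trans    : ∀ {x y z} → x ≤ y → y ≤ z → x ≤ z
    ≤-antisym  : ∀ {x y} → x ≤ y → y ≤ x → x ≈ y
    ≤-total    : ∀ x y → (x ≤ y) ⊎ (y ≤ x)
    ≤-resp-≈   : ∀ {x x′ y y′} → x ≈ x′ → y ≈ y′ → x ≤ y → x′ ≤ y′
    +-mono-≤   : ∀ {x y} z → x ≤ y → (x + z) ≤ (y + z)
    *-nonneg   : ∀ {x y} → 0# ≤ x → 0# ≤ y → 0# ≤ (x * y)
    1≉0        : ¬ (1# ≈ 0#)
    inverse    : ∀ x → ¬ (x ≈ 0#) → ∃ λ y → (x * y) ≈ 1#
    supremum   : (P : Carrier → Set ℓ) → ∃ P → (∃ λ b → ∀ x → P x → x ≤ b) →
                 ∃ λ s → (∀ x → P x → x ≤ s) × (∀ b → (∀ x → P x → x ≤ b) → s ≤ b)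

module _ {c ℓ : Level} (ℝ : RealField c ℓ) where
  open RealField ℝ

  Σ[_] : (r : ℕ) → (Fin r → Carrier) → Carrier
  Σ[ nzero ] f = 0#
  Σ[ nsuc r ] f = f fzero + Σ[ r ] (λ i → f (fsuc i))

  Matrix : ℕ → Set c
  Matrix r = Fin r → Fin r → Carrier

  Tr-mul : ∀ {r} → Matrix r → Matrix r → Carrier
  Tr-mul {r} E F = Σ[ r ] (λ i → Σ[ r ] (λ k → E i k * F k i))

  IsPSD : ∀ {r} → Matrix r → Set (c ⊔ ℓ)
  IsPSD {r} M = (∀ i j → M i j ≈ M j i) ×
                (∀ (v : Fin r → Carrier) → 0# ≤ Σ[ r ] (λ i → Σ[ r ] (λ j → v i * M i j * v j)))

  PSDFactorization : {I J : Set} → (I → J → Carrier) → ℕ → Set (c ⊔ ℓ)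
  PSDFactorization {I} {J} A r =
    Σ (I → Matrix r) λ E → Σ (J → Matrix r) λ F →
      (∀ i → IsPSD (E i)) × (∀ j → IsPSD (F j)) × (∀ i j → A i j ≈ Tr-mul (E i) (F j))

  -- rank_psd(A) ≤ b  iff some factorization of size r ≤ b exists
  -- (the rank is the least such size)

  bit : Bool → Carrier
  bit b = if b then 1# else 0#

ipBit : (n : ℕ) → (Fin n → Bool) → (Fin n → Bool) → Bool
ipBit nzero x y = false
ipBit (nsuc n) x y = (x fzero ∧ y fzero) xor ipBit n (λ i → x (fsuc i)) (λ i → y (fsuc i))

IP : ∀ {c ℓ} (ℝ : RealField c ℓ) (n : ℕ) → (Fin n → Bool) → (Fin n → Bool) → RealField.Carrier ℝ
IP ℝ n x y = bit ℝ (ipBit n x y)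

module Submission where

-- Split n = a + b and write x = (x_A , x_B) for x ∈ {0,1}^n.  Index the
-- coordinates of ℝ^(2^a + 2^b) by the disjoint union {0,1}^a ⊎ {0,1}^b and put
--   u(x) = e_{x_A} ⊕ e_{x_B},     v(y) = (IP_a(z , y_A))_z ⊕ (- IP_b(z , y_B))_z .
-- Then ⟨u(x) , v(y)⟩ = p - q with p = IP_a(x_A , y_A) and q = IP_b(x_B , y_B)
-- bits, and (p - q)² = p xor q = IP_n(x , y).  Since Tr(u uᵀ v vᵀ) = ⟨u , v⟩²
-- and rank-one matrices w wᵀ are PSD, E_x = u(x) u(x)ᵀ and F_y = v(y) v(y)ᵀ form
-- a PSD factorization of size 2^a + 2^b.  Taking a = b = n/2 gives size 2·2^(n/2)
-- for even n, and a = b + 1 gives size 3·2^((n-1)/2) for odd n.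

open import Defs
open import Level using (Level)
open import Data.Nat using (ℕ; _≤_; _*_; _^_; _%_)
open import Data.Product using (∃; _×_)
open import Relation.Binary.PropositionalEquality using (_≡_)

open import Data.Nat using (zero; suc; _+_)
open import Data.Nat.Properties using (≤-reflexive; +-suc; ^-distribˡ-+-*; 0≢1+n)
open import Data.Nat.DivMod using (m*n%n≡0; [m+kn]%n≡m%n)
open import Data.Nat.Tactic.RingSolver using (solve-∀)
open import Data.Fin using (splitAt) renaming (zero to fzero; suc to fsuc)
open import Data.Vec.Functional using (Vector; _∷_; []; _++_; head; tail; take; drop; replicate)
open import Data.Bool using (Bool; true; false; _xor_; _∧_)
open import Data.Bool.Properties using (xor-assoc)
open import Data.Sum using (inj₁; inj₂)
open import Data.Product using (_,_)
open import Data.Empty using (⊥-elim)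
open import Relation.Binary.PropositionalEquality
  using (refl; sym; trans; cong; cong₂; subst; _≗_)

ipBit-++ : ∀ a b (x y : Vector Bool (a + b)) →
  ipBit (a + b) x y ≡ ipBit a (take a x) (take a y) xor ipBit b (drop a x) (drop a y)
ipBit-++ zero    b x y = refl
ipBit-++ (suc a) b x y =
  trans (cong (head x ∧ head y xor_) (ipBit-++ a b (tail x) (tail y)))
        (sym (xor-assoc (head x ∧ head y) _ _))

-- ipBit only depends on the entries of its arguments (there is no function
-- extensionality, so this has to be proved).
ipBit-cong : ∀ n {x x′ y y′ : Vector Bool n} → x ≗ x′ → y ≗ y′ →
  ipBit n x y ≡ ipBit n x′ y′
ipBit-cong zero    _   _   = refl
ipBit-cong (suc n) x≗x′ y≗y′ =
  cong₂ _xor_ (cong₂ _∧_ (x≗x′ fzero) (y≗y′ fzero))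
              (ipBit-cong n (tail-≗ x≗x′) (tail-≗ y≗y′))
  where
    tail-≗ : ∀ {u w : Vector Bool (suc n)} → u ≗ w → tail u ≗ tail w
    tail-≗ u≗w i = u≗w (fsuc i)

head∷tail : ∀ {n} (x : Vector Bool (suc n)) → (head x ∷ tail x) ≗ x
head∷tail x fzero    = refl
head∷tail x (fsuc i) = refl

module Factorization {c ℓ : Level} (ℝ : RealField c ℓ) where
  open RealField ℝ
    renaming (_+_ to _+ᵣ_; _*_ to _*ᵣ_; _≤_ to _≤ᵣ_; refl to ≈-refl; sym to ≈-sym; trans to ≈-trans)
  open import Algebra.Properties.Ring ring using (-‿distribˡ-*; -‿distribʳ-*; -‿involutive; -0#≈0#)
  open import Algebra.Properties.CommutativeSemigroup *-commutativeSemigroup using (interchange)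
  open import Relation.Binary.Reasoning.Setoid setoid

  Σ : (r : ℕ) → Vector Carrier r → Carrier
  Σ = Σ[_] ℝ

  Σ-cong : ∀ r {f g : Vector Carrier r} → (∀ i → f i ≈ g i) → Σ r f ≈ Σ r g
  Σ-cong zero    f≈g = ≈-refl
  Σ-cong (suc r) f≈g = +-cong (f≈g fzero) (Σ-cong r (λ i → f≈g (fsuc i)))

  Σ-zero : ∀ r → Σ r (replicate r 0#) ≈ 0#
  Σ-zero zero    = ≈-refl
  Σ-zero (suc r) = ≈-trans (+-congˡ (Σ-zero r)) (+-identityʳ 0#)

  Σ-*ˡ : ∀ r x f → Σ r (λ i → x *ᵣ f i) ≈ x *ᵣ Σ r f
  Σ-*ˡ zero    x f = ≈-sym (zeroʳ x)
  Σ-*ˡ (suc r) x f = ≈-trans (+-congˡ (Σ-*ˡ r x (tail f))) (≈-sym (distribˡ x _ _))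

  Σ-*ʳ : ∀ r x f → Σ r (λ i → f i *ᵣ x) ≈ Σ r f *ᵣ x
  Σ-*ʳ r x f = ≈-trans (Σ-cong r (λ i → *-comm (f i) x))
                       (≈-trans (Σ-*ˡ r x f) (*-comm x _))

  Σ-square : ∀ r (f : Vector Carrier r) →
    Σ r (λ i → Σ r (λ k → f i *ᵣ f k)) ≈ Σ r f *ᵣ Σ r f
  Σ-square r f = ≈-trans (Σ-cong r (λ i → Σ-*ˡ r (f i) f)) (Σ-*ʳ r (Σ r f) f)

  ++-tail : ∀ a {b} (u : Vector Carrier (suc a)) (v : Vector Carrier b) i →
    (u ++ v) (fsuc i) ≡ (tail u ++ v) i
  ++-tail a u v i with splitAt a i
  ... | inj₁ j = refl
  ... | inj₂ j = refl

  Σ-++ : ∀ a {b} (u : Vector Carrier a) (v : Vector Carrier b) →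
    Σ (a + b) (u ++ v) ≈ Σ a u +ᵣ Σ b v
  Σ-++ zero    u v = ≈-sym (+-identityˡ _)
  Σ-++ (suc a) {b} u v = begin
    u fzero +ᵣ Σ (a + b) (λ i → (u ++ v) (fsuc i))
      ≈⟨ +-congˡ (Σ-cong (a + b) (λ i → reflexive (++-tail a u v i))) ⟩
    u fzero +ᵣ Σ (a + b) (tail u ++ v)
      ≈⟨ +-congˡ (Σ-++ a (tail u) v) ⟩
    u fzero +ᵣ (Σ a (tail u) +ᵣ Σ b v)
      ≈⟨ +-assoc _ _ _ ⟨
    Σ (suc a) u +ᵣ Σ b v ∎

  dot : ∀ r → Vector Carrier r → Vector Carrier r → Carrier
  dot r u v = Σ r (λ i → u i *ᵣ v i)

  ++-*ᵣ : ∀ a {b} (u u′ : Vector Carrier a) (v v′ : Vector Carrier b) i →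
    (u ++ v) i *ᵣ (u′ ++ v′) i ≡ ((λ j → u j *ᵣ u′ j) ++ (λ j → v j *ᵣ v′ j)) i
  ++-*ᵣ a u u′ v v′ i with splitAt a i
  ... | inj₁ j = refl
  ... | inj₂ j = refl

  dot-++ : ∀ a {b} (u u′ : Vector Carrier a) (v v′ : Vector Carrier b) →
    dot (a + b) (u ++ v) (u′ ++ v′) ≈ dot a u u′ +ᵣ dot b v v′
  dot-++ a {b} u u′ v v′ =
    ≈-trans (Σ-cong (a + b) (λ i → reflexive (++-*ᵣ a u u′ v v′ i))) (Σ-++ a _ _)

  dot-zeroˡ : ∀ r w → dot r (replicate r 0#) w ≈ 0#
  dot-zeroˡ r w = ≈-trans (Σ-cong r (λ i → zeroˡ (w i))) (Σ-zero r)

  -- Vectors indexed by bit strings.  ℝ^(2^(k+1)) is ℝ^(2^k) ⊕ ℝ^(2^k) ⊕ ℝ^0, the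
  -- two halves corresponding to the value of the first bit.

  place : ∀ {m} → Bool → Vector Carrier m → Vector Carrier (m + (m + 0))
  place {m} false u = u ++ (replicate m 0# ++ [])
  place {m} true  u = replicate m 0# ++ (u ++ [])

  halves : ∀ {m} → (Bool → Vector Carrier m) → Vector Carrier (m + (m + 0))
  halves t = t false ++ (t true ++ [])

  dot-place-halves : ∀ {m} b (u : Vector Carrier m) t →
    dot (m + (m + 0)) (place b u) (halves t) ≈ dot m u (t b)
  dot-place-halves {m} false u t = begin
    dot (m + (m + 0)) (place false u) (halves t)
      ≈⟨ dot-++ m _ _ _ _ ⟩
    dot m u (t false) +ᵣ dot (m + 0) (replicate m 0# ++ []) (t true ++ [])
      ≈⟨ +-congˡ (≈-trans (dot-++ m _ _ _ _) (≈-trans (+-identityʳ _) (dot-zeroˡ m _))) ⟩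
    dot m u (t false) +ᵣ 0#
      ≈⟨ +-identityʳ _ ⟩
    dot m u (t false) ∎
  dot-place-halves {m} true u t = begin
    dot (m + (m + 0)) (place true u) (halves t)
      ≈⟨ dot-++ m _ _ _ _ ⟩
    dot m (replicate m 0#) (t false) +ᵣ dot (m + 0) (u ++ []) (t true ++ [])
      ≈⟨ +-cong (dot-zeroˡ m _) (≈-trans (dot-++ m _ _ _ _) (+-identityʳ _)) ⟩
    0# +ᵣ dot m u (t true)
      ≈⟨ +-identityˡ _ ⟩
    dot m u (t true) ∎

  indicator : ∀ k → Vector Bool k → Vector Carrier (2 ^ k)
  indicator zero    x = replicate 1 1#
  indicator (suc k) x = place (head x) (indicator k (tail x))

  table : ∀ k → (Vector Bool k → Carrier) → Vector Carrier (2 ^ k)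
  table zero    g = replicate 1 (g [])
  table (suc k) g = halves (λ b → table k (λ z → g (b ∷ z)))

  Respects≗ : ∀ {k} → (Vector Bool k → Carrier) → Set ℓ
  Respects≗ g = ∀ {x x′} → x ≗ x′ → g x ≈ g x′

  Respects≗-∷ : ∀ {k} {g : Vector Bool (suc k) → Carrier} → Respects≗ g →
    ∀ b → Respects≗ (λ z → g (b ∷ z))
  Respects≗-∷ resp b z≗z′ = resp λ { fzero → refl ; (fsuc i) → z≗z′ i }

  dot-indicator-table : ∀ k x g → Respects≗ g → dot (2 ^ k) (indicator k x) (table k g) ≈ g x
  dot-indicator-table zero    x g resp =
    ≈-trans (+-identityʳ _) (≈-trans (*-identityˡ _) (resp (λ ())))
  dot-indicator-table (suc k) x g resp = begin
    dot (2 ^ suc k) (indicator (suc k) x) (table (suc k) g)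
      ≈⟨ dot-place-halves (head x) _ (λ b → table k (λ z → g (b ∷ z))) ⟩
    dot (2 ^ k) (indicator k (tail x)) (table k (λ z → g (head x ∷ z)))
      ≈⟨ dot-indicator-table k (tail x) _ (Respects≗-∷ resp (head x)) ⟩
    g (head x ∷ tail x)
      ≈⟨ resp (head∷tail x) ⟩
    g x ∎

  ip-respects≗ : ∀ k (w : Vector Bool k) → Respects≗ (λ z → bit ℝ (ipBit k z w))
  ip-respects≗ k w z≗z′ = reflexive (cong (bit ℝ) (ipBit-cong k z≗z′ (λ _ → refl)))

  -‿square : ∀ x → (- x) *ᵣ (- x) ≈ x *ᵣ x
  -‿square x = begin
    (- x) *ᵣ (- x)   ≈⟨ -‿distribˡ-* x (- x) ⟨
    - (x *ᵣ (- x))   ≈⟨ -‿cong (-‿distribʳ-* x x) ⟨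
    - (- (x *ᵣ x))   ≈⟨ -‿involutive _ ⟩
    x *ᵣ x ∎

  square-nonneg : ∀ x → 0# ≤ᵣ (x *ᵣ x)
  square-nonneg x with ≤-total 0# x
  ... | inj₁ 0≤x = *-nonneg 0≤x 0≤x
  ... | inj₂ x≤0 = ≤-resp-≈ ≈-refl (-‿square x) (*-nonneg 0≤-x 0≤-x)
    where
      0≤-x : 0# ≤ᵣ (- x)
      0≤-x = ≤-resp-≈ (-‿inverseʳ x) (+-identityˡ (- x)) (+-mono-≤ (- x) x≤0)

  outer : ∀ {r} → Vector Carrier r → Matrix ℝ r
  outer w i j = w i *ᵣ w j

  -- w wᵀ is PSD: its quadratic form is vᵀ w wᵀ v = ⟨v , w⟩².
  outer-isPSD : ∀ r (w : Vector Carrier r) → IsPSD ℝ (outer w)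
  outer-isPSD r w = (λ i j → *-comm (w i) (w j)) , quadratic-form-nonneg
    where
      regroup : ∀ a b c d → (a *ᵣ (b *ᵣ c)) *ᵣ d ≈ (a *ᵣ b) *ᵣ (d *ᵣ c)
      regroup a b c d =
        ≈-trans (*-congʳ (≈-sym (*-assoc a b c))) (≈-trans (*-assoc _ c d) (*-congˡ (*-comm c d)))
      quadratic-form-nonneg : ∀ v → 0# ≤ᵣ Σ r (λ i → Σ r (λ j → v i *ᵣ outer w i j *ᵣ v j))
      quadratic-form-nonneg v = ≤-resp-≈ ≈-refl
        (≈-sym (≈-trans (Σ-cong r (λ i → Σ-cong r (λ j → regroup (v i) (w i) (w j) (v j))))
                        (Σ-square r (λ i → v i *ᵣ w i))))
        (square-nonneg _)

  Tr-outer : ∀ r (u v : Vector Carrier r) → Tr-mul ℝ (outer u) (outer v) ≈ dot r u v *ᵣ dot r u v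
  Tr-outer r u v = ≈-trans (Σ-cong r (λ i → Σ-cong r (λ k → regroup (u i) (u k) (v k) (v i))))
                           (Σ-square r (λ i → u i *ᵣ v i))
    where
      regroup : ∀ a b c d → (a *ᵣ b) *ᵣ (c *ᵣ d) ≈ (a *ᵣ d) *ᵣ (b *ᵣ c)
      regroup a b c d = ≈-trans (*-congˡ (*-comm c d)) (interchange a b d c)

  bit-xor : ∀ p q → bit ℝ (p xor q) ≈ (bit ℝ p - bit ℝ q) *ᵣ (bit ℝ p - bit ℝ q)
  bit-xor false false = ≈-sym (≈-trans (*-congʳ (-‿inverseʳ 0#)) (zeroˡ _))
  bit-xor true  true  = ≈-sym (≈-trans (*-congʳ (-‿inverseʳ 1#)) (zeroˡ _))
  bit-xor true  false = ≈-sym (≈-trans (*-cong 1-0≈1 1-0≈1) (*-identityˡ 1#))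
    where 1-0≈1 = ≈-trans (+-congˡ -0#≈0#) (+-identityʳ 1#)
  bit-xor false true  = ≈-sym (begin
    (0# - 1#) *ᵣ (0# - 1#) ≈⟨ *-cong (+-identityˡ (- 1#)) (+-identityˡ (- 1#)) ⟩
    (- 1#) *ᵣ (- 1#)       ≈⟨ -‿square 1# ⟩
    1# *ᵣ 1#               ≈⟨ *-identityˡ 1# ⟩
    1# ∎)

  ip-factorization : ∀ a b → PSDFactorization ℝ (IP ℝ (a + b)) (2 ^ a + 2 ^ b)
  ip-factorization a b =
    (λ x → outer (u x)) , (λ y → outer (v y)) ,
    (λ x → outer-isPSD _ (u x)) , (λ y → outer-isPSD _ (v y)) , entries
    where
      u : Vector Bool (a + b) → Vector Carrier (2 ^ a + 2 ^ b)
      u x = indicator a (take a x) ++ indicator b (drop a x)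
      v : Vector Bool (a + b) → Vector Carrier (2 ^ a + 2 ^ b)
      v y = table a (λ z → bit ℝ (ipBit a z (take a y)))
         ++ table b (λ z → - bit ℝ (ipBit b z (drop a y)))

      ⟨u,v⟩ : ∀ x y → dot (2 ^ a + 2 ^ b) (u x) (v y) ≈
        bit ℝ (ipBit a (take a x) (take a y)) - bit ℝ (ipBit b (drop a x) (drop a y))
      ⟨u,v⟩ x y = ≈-trans (dot-++ (2 ^ a) _ _ _ _)
        (+-cong (dot-indicator-table a _ _ (ip-respects≗ a (take a y)))
                (dot-indicator-table b _ _ (λ z≗z′ → -‿cong (ip-respects≗ b (drop a y) z≗z′))))

      entries : ∀ x y → IP ℝ (a + b) x y ≈ Tr-mul ℝ (outer (u x)) (outer (v y))
      entries x y = begin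
        bit ℝ (ipBit (a + b) x y)      ≡⟨ cong (bit ℝ) (ipBit-++ a b x y) ⟩
        bit ℝ (p xor q)                ≈⟨ bit-xor p q ⟩
        (bit ℝ p - bit ℝ q) *ᵣ (bit ℝ p - bit ℝ q)
          ≈⟨ *-cong (⟨u,v⟩ x y) (⟨u,v⟩ x y) ⟨
        dot _ (u x) (v y) *ᵣ dot _ (u x) (v y)
          ≈⟨ Tr-outer _ (u x) (v y) ⟨
        Tr-mul ℝ (outer (u x)) (outer (v y)) ∎
        where
          p = ipBit a (take a x) (take a y)
          q = ipBit b (drop a x) (drop a y)

data Parity : ℕ → Set where
  even : ∀ a → Parity (a + a)
  odd  : ∀ a → Parity (suc (a + a))

parity : ∀ n → Parity n
parity zero = even 0
parity (suc n) with parity n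
... | even a = odd a
... | odd a  = subst Parity (cong suc (+-suc a a)) (even (suc a))

even-%2 : ∀ a → (a + a) % 2 ≡ 0
even-%2 a = trans (cong (_% 2) (a+a≡a*2 a)) (m*n%n≡0 a 2)
  where
    a+a≡a*2 : ∀ a → a + a ≡ a * 2
    a+a≡a*2 = solve-∀

odd-%2 : ∀ a → suc (a + a) % 2 ≡ 1
odd-%2 a = trans (cong (_% 2) (1+a+a≡1+a*2 a)) ([m+kn]%n≡m%n 1 a 2)
  where
    1+a+a≡1+a*2 : ∀ a → suc (a + a) ≡ 1 + a * 2
    1+a+a≡1+a*2 = solve-∀

even-size : ∀ a → (2 ^ a + 2 ^ a) * (2 ^ a + 2 ^ a) ≡ 4 * 2 ^ (a + a)
even-size a = trans (square-double (2 ^ a)) (cong (4 *_) (sym (^-distribˡ-+-* 2 a a)))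
  where
    square-double : ∀ X → (X + X) * (X + X) ≡ 4 * (X * X)
    square-double = solve-∀

odd-size : ∀ a → 2 * ((2 ^ suc a + 2 ^ a) * (2 ^ suc a + 2 ^ a)) ≡ 9 * 2 ^ (suc a + a)
odd-size a = trans (twice-square-triple (2 ^ a)) (cong (λ t → 9 * (2 * t)) (sym (^-distribˡ-+-* 2 a a)))
  where
    twice-square-triple : ∀ X → 2 * ((2 * X + X) * (2 * X + X)) ≡ 9 * (2 * (X * X))
    twice-square-triple = solve-∀

mainTheorem11 : ∀ {c ℓ} (ℝ : RealField c ℓ) (n : ℕ) → 1 ≤ n →
    ∃ λ r → PSDFactorization ℝ (IP ℝ n) r ×
      (n % 2 ≡ 0 → r * r ≤ 4 * 2 ^ n) ×
      (n % 2 ≡ 1 → 2 * (r * r) ≤ 9 * 2 ^ n)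
mainTheorem11 ℝ n _ with parity n
... | even a = 2 ^ a + 2 ^ a , Factorization.ip-factorization ℝ a a ,
               (λ _ → ≤-reflexive (even-size a)) ,
               (λ n%2≡1 → ⊥-elim (0≢1+n (trans (sym (even-%2 a)) n%2≡1)))
... | odd a  = 2 ^ suc a + 2 ^ a , Factorization.ip-factorization ℝ (suc a) a ,
               (λ n%2≡0 → ⊥-elim (0≢1+n (trans (sym n%2≡0) (odd-%2 a)))) ,
               (λ _ → ≤-reflexive (odd-size a))
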